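{- Let $n\ge 2$ be an integer, let $d_1<d_2<\dots<d_w$ be all proper positive divisors of $n$, and for each $i$ let $A_{d_i}=\{x\in\{0,\dots,n-1\}:\gcd(x,n)=d_i\}$. Let $G_2$ be the induced subgraph of the comaximal graph $\Gamma(\mathbb{Z}_n)$ on the set of nonzero non-units of $\mathbb{Z}_n$. Then $V(G_2)=\bigcup_{i=1}^w A_{d_i}$ is an equitable partition of $G_2$.
   Context: The comaximal graph $\Gamma(\mathbb{Z}_n)$ has vertex set $\mathbb{Z}_n=\{0,1,\dots,n-1\}$, distinct $x,y$ adjacent iff $\langle x\rangle+\langle y\rangle=\mathbb{Z}_n$. A proper divisor of $n$ is a positive divisor different from $1$ and $n$. A partition $V(G)=V_1\cup\dots\cup V_k$ of the vertex set of a graph $G$ is equitable if for all $1\le i,j\le k$ every vertex of $V_i$ has the same number $b_{ij}$ of neighbours in $V_j$. -}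

module Defs where

open import Data.Nat using (ℕ; _+_; _*_; _≟_; NonZero)
open import Data.Nat.DivMod using (_%_)
open import Data.Nat.Divisibility using (_∣_)
open import Data.Nat.GCD using (gcd)
open import Data.Fin using (Fin; toℕ)
import Data.Fin as F
open import Data.Fin.Properties using (any?)
open import Data.List using (List; length; filter)
open import Data.List.Base using ()
open import Data.Fin using ()
open import Data.Product using (_×_; ∃; ∃-syntax; _,_)
open import Relation.Nullary using (¬_; Dec; ¬?)
open import Relation.Nullary.Decidable using (_×-dec_)
open import Relation.Binary.PropositionalEquality using (_≡_; _≢_)
open import Data.List using (allFin) public

-- Vertices of Γ(ℤ_n) are the elements of Fin n (representatives 0,…,n-1).

ProperDivisor : ℕ → ℕ → Set
ProperDivisor n d = d ∣ n × d ≢ 1 × d ≢ n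

IsUnit : (n : ℕ) .{{_ : NonZero n}} → Fin n → Set
IsUnit n x = ∃[ a ] ((toℕ {n} a * toℕ x) % n ≡ 1 % n)

InG₂ : (n : ℕ) .{{_ : NonZero n}} → Fin n → Set
InG₂ n x = toℕ x ≢ 0 × ¬ IsUnit n x

-- comaximal adjacency: x ≠ y and ⟨x⟩ + ⟨y⟩ = ℤ_n, i.e. 1 ∈ ⟨x⟩ + ⟨y⟩,
-- i.e. a·x + b·y = 1 in ℤ_n for some a, b ∈ ℤ_n.
Adj : (n : ℕ) .{{_ : NonZero n}} → Fin n → Fin n → Set
Adj n x y = x ≢ y × ∃[ a ] ∃[ b ] ((toℕ {n} a * toℕ x + toℕ {n} b * toℕ y) % n ≡ 1 % n)

adj? : (n : ℕ) .{{_ : NonZero n}} → (x y : Fin n) → Dec (Adj n x y)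
adj? n x y = ¬? (x F.≟ y) ×-dec any? (λ a → any? (λ b →
  ((toℕ {n} a * toℕ x + toℕ {n} b * toℕ y) % n) ≟ (1 % n)))

InA : (n : ℕ) → ℕ → Fin n → Set
InA n d x = gcd (toℕ x) n ≡ d

-- number of neighbours (in Γ(ℤ_n), equivalently in the induced subgraph G₂
-- since A_d ⊆ V(G₂) for proper d) of x lying in A_d
nbrsIn : (n : ℕ) .{{_ : NonZero n}} → Fin n → ℕ → ℕ
nbrsIn n x d = length (filter (λ z → (gcd (toℕ z) n ≟ d) ×-dec adj? n x z) (allFin n))

-- Everything is governed by gcd(x, n). An element x of ℤ_n is a unit iff gcd(x, n) = 1 and is
-- zero iff gcd(x, n) = n, so the cells A_d with d a proper divisor are exactly the vertices of G₂.
-- By Bézout, 1 ∈ ⟨x⟩ + ⟨z⟩ iff gcd(gcd(x, n), z) = 1, and for a non-unit x this also forces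
-- z ≠ x. Hence adjacency to z depends on x only through gcd(x, n): two vertices of the same cell
-- have the same neighbours, in particular the same number of them in every cell.
module Submission where

open import Defs
open import Data.Nat using (ℕ; _≤_; _<_; NonZero; suc; _+_; _*_)
open import Data.Fin using (Fin)
open import Data.Product using (_×_; ∃-syntax)
open import Function.Bundles using (_⇔_)
open import Relation.Binary.PropositionalEquality using (_≡_)

open import Data.Nat.Properties using (+-comm; *-assoc; ≤∧≢⇒<)
open import Data.Nat.DivMod using (_%_; _/_; _mod_; %-distribˡ-+; %-distribˡ-*; m%n%n≡m%n;
  [m+kn]%n≡m%n; m≡m%n+[m/n]*n; m%n<n; m<n⇒m%n≡m)
open import Data.Nat.Divisibility using (_∣_; ∣-trans; ∣m∣n⇒∣m+n; ∣m+n∣m⇒∣n; ∣n⇒∣m*n; ∣1⇒≡1;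
  ∣⇒≤; n∣m⇒m%n≡0)
open import Data.Nat.GCD using (gcd; gcd[m,n]∣m; gcd[m,n]∣n; gcd-universality;
  gcd-identityˡ; gcd-GCD; module Bézout)
open import Data.Nat.Tactic.RingSolver using (solve-∀)
open import Data.Fin using (toℕ; fromℕ<)
open import Data.Fin.Properties using (toℕ-fromℕ<; toℕ<n)
open import Data.List using (length)
open import Data.List.Properties using (filter-≐)
open import Data.Product using (_,_; map₂)
open import Function using (_∘_)
open import Function.Bundles using (mk⇔; Equivalence)
open import Relation.Binary.PropositionalEquality using (refl; sym; trans; cong; cong₂; subst; _≢_;
  module ≡-Reasoning)

open Equivalence using (to; from)

%-cong-+ : ∀ {a a′ b b′} n .{{_ : NonZero n}} →
  a % n ≡ a′ % n → b % n ≡ b′ % n → (a + b) % n ≡ (a′ + b′) % n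
%-cong-+ {a} {a′} {b} {b′} n ea eb = begin
  (a + b) % n               ≡⟨ %-distribˡ-+ a b n ⟩
  (a % n + b % n) % n       ≡⟨ cong₂ (λ s t → (s + t) % n) ea eb ⟩
  (a′ % n + b′ % n) % n     ≡⟨ %-distribˡ-+ a′ b′ n ⟨
  (a′ + b′) % n             ∎
  where open ≡-Reasoning

%-cong-* : ∀ {a a′ b b′} n .{{_ : NonZero n}} →
  a % n ≡ a′ % n → b % n ≡ b′ % n → (a * b) % n ≡ (a′ * b′) % n
%-cong-* {a} {a′} {b} {b′} n ea eb = begin
  (a * b) % n               ≡⟨ %-distribˡ-* a b n ⟩
  (a % n * (b % n)) % n     ≡⟨ cong₂ (λ s t → (s * t) % n) ea eb ⟩
  (a′ % n * (b′ % n)) % n   ≡⟨ %-distribˡ-* a′ b′ n ⟨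
  (a′ * b′) % n             ∎
  where open ≡-Reasoning

mod-coefficient : ∀ a x n .{{_ : NonZero n}} → (toℕ (a mod n) * x) % n ≡ (a * x) % n
mod-coefficient a x n =
  %-cong-* n (trans (cong (_% n) (toℕ-fromℕ< (m%n<n a n))) (m%n%n≡m%n a n)) refl

∣m∣n⇒∣m%n : ∀ {d} m n .{{_ : NonZero n}} → d ∣ m → d ∣ n → d ∣ m % n
∣m∣n⇒∣m%n m n d∣m d∣n = ∣m+n∣m⇒∣n
  (subst (_ ∣_) (trans (m≡m%n+[m/n]*n m n) (+-comm (m % n) _)) d∣m)
  (∣n⇒∣m*n (m / n) d∣n)

∣m%n∣n⇒∣m : ∀ {d} m n .{{_ : NonZero n}} → d ∣ m % n → d ∣ n → d ∣ m
∣m%n∣n⇒∣m m n d∣m%n d∣n =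
  subst (_ ∣_) (sym (m≡m%n+[m/n]*n m n)) (∣m∣n⇒∣m+n d∣m%n (∣n⇒∣m*n (m / n) d∣n))

∣m∣n∧m%n≡1%n⇒∣1 : ∀ {d} m n .{{_ : NonZero n}} → d ∣ m → d ∣ n → m % n ≡ 1 % n → d ∣ 1
∣m∣n∧m%n≡1%n⇒∣1 m n d∣m d∣n eq =
  ∣m%n∣n⇒∣m 1 n (subst (_ ∣_) eq (∣m∣n⇒∣m%n m n d∣m d∣n)) d∣n

m∣n⇒gcd[m,n]≡m : ∀ {m n} → m ∣ n → gcd m n ≡ m
m∣n⇒gcd[m,n]≡m m∣n = sym (gcd-universality (λ (d∣m , _) → d∣m) (λ d∣m → d∣m , ∣-trans d∣m m∣n))

-- k represents −1 modulo k + 1, which turns the negative term of a ℕ-valued Bézout identity positive.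
cancel-negative : ∀ k {g a y q} → g + y * q ≡ a → (a + k * y * q) % suc k ≡ g % suc k
cancel-negative k {g} {a} {y} {q} eq = begin
  (a + k * y * q) % suc k           ≡⟨ cong (λ t → (t + k * y * q) % suc k) eq ⟨
  (g + y * q + k * y * q) % suc k   ≡⟨ cong (_% suc k) (distrib g y q k) ⟩
  (g + y * q * suc k) % suc k       ≡⟨ [m+kn]%n≡m%n g (y * q) (suc k) ⟩
  g % suc k                         ∎
  where
  open ≡-Reasoning
  distrib : ∀ g y q k → g + y * q + k * y * q ≡ g + y * q * suc k
  distrib = solve-∀

bézout-% : ∀ p q n .{{_ : NonZero n}} → ∃[ u ] ∃[ v ] ((u * p + v * q) % n ≡ gcd p q % n)
bézout-% p q (suc k) with Bézout.identity (gcd-GCD p q)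
... | Bézout.+- x y eq = x , k * y , cancel-negative k eq
... | Bézout.-+ x y eq = k * x , y ,
  trans (cong (_% suc k) (+-comm (k * x * p) (y * q))) (cancel-negative k eq)

gcd-multiple-% : ∀ x n .{{_ : NonZero n}} → ∃[ s ] ((s * x) % n ≡ gcd x n % n)
gcd-multiple-% x n with bézout-% x n n
... | s , t , eq = s , trans (sym ([m+kn]%n≡m%n (s * x) t n)) eq

isUnit⇔gcd≡1 : ∀ n .{{_ : NonZero n}} (x : Fin n) → IsUnit n x ⇔ gcd (toℕ x) n ≡ 1
isUnit⇔gcd≡1 n x = mk⇔
  (λ (a , eq) → ∣1⇒≡1 (∣m∣n∧m%n≡1%n⇒∣1 (toℕ a * toℕ x) n
     (∣n⇒∣m*n (toℕ a) (gcd[m,n]∣m (toℕ x) n)) (gcd[m,n]∣n (toℕ x) n) eq))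
  (λ gcd≡1 → let (s , eq) = gcd-multiple-% (toℕ x) n in
     s mod n , trans (mod-coefficient s (toℕ x) n) (trans eq (cong (_% n) gcd≡1)))

gcd≡n⇔≡0 : ∀ n .{{_ : NonZero n}} (x : Fin n) → gcd (toℕ x) n ≡ n ⇔ toℕ x ≡ 0
gcd≡n⇔≡0 n x = mk⇔
  (λ gcd≡n → trans (sym (m<n⇒m%n≡m (toℕ<n x)))
     (n∣m⇒m%n≡0 (toℕ x) n (subst (_∣ toℕ x) gcd≡n (gcd[m,n]∣m (toℕ x) n))))
  (λ x≡0 → trans (cong (λ t → gcd t n) x≡0) (gcd-identityˡ n))

Comaximal : (n : ℕ) .{{_ : NonZero n}} → Fin n → Fin n → Set
Comaximal n x z = ∃[ a ] ∃[ b ] ((toℕ {n} a * toℕ x + toℕ {n} b * toℕ z) % n ≡ 1 % n)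

comaximal⇔gcd≡1 : ∀ n .{{_ : NonZero n}} (x z : Fin n) →
  Comaximal n x z ⇔ gcd (gcd (toℕ x) n) (toℕ z) ≡ 1
comaximal⇔gcd≡1 n x z = mk⇔ comaximal⇒ comaximal⇐
  where
  X Z G : ℕ
  X = toℕ x
  Z = toℕ z
  G = gcd (gcd X n) Z

  comaximal⇒ : Comaximal n x z → G ≡ 1
  comaximal⇒ (a , b , eq) = ∣1⇒≡1 (∣m∣n∧m%n≡1%n⇒∣1 _ n
    (∣m∣n⇒∣m+n (∣n⇒∣m*n (toℕ a) G∣X) (∣n⇒∣m*n (toℕ b) (gcd[m,n]∣n (gcd X n) Z))) G∣n eq)
    where
    G∣X : G ∣ X
    G∣X = ∣-trans (gcd[m,n]∣m (gcd X n) Z) (gcd[m,n]∣m X n)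
    G∣n : G ∣ n
    G∣n = ∣-trans (gcd[m,n]∣m (gcd X n) Z) (gcd[m,n]∣n X n)

  -- s x ≡ gcd(x,n) and u gcd(x,n) + v z ≡ G (mod n), so (u s) x + v z ≡ G ≡ 1.
  comaximal⇐ : G ≡ 1 → Comaximal n x z
  comaximal⇐ G≡1 with gcd-multiple-% X n | bézout-% (gcd X n) Z n
  ... | s , sX | u , v , uv = (u * s) mod n , v mod n , (begin
    (toℕ ((u * s) mod n) * X + toℕ (v mod n) * Z) % n
      ≡⟨ %-cong-+ n (mod-coefficient (u * s) X n) (mod-coefficient v Z n) ⟩
    (u * s * X + v * Z) % n
      ≡⟨ %-cong-+ n (trans (cong (_% n) (*-assoc u s X)) (%-cong-* {u} n refl sX)) refl ⟩
    (u * gcd X n + v * Z) % n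
      ≡⟨ trans uv (cong (_% n) G≡1) ⟩
    1 % n ∎)
    where open ≡-Reasoning

adj⇔gcd≡1 : ∀ n .{{_ : NonZero n}} (x z : Fin n) → gcd (toℕ x) n ≢ 1 →
  Adj n x z ⇔ gcd (gcd (toℕ x) n) (toℕ z) ≡ 1
adj⇔gcd≡1 n x z gcd≢1 = mk⇔
  (λ (_ , com) → to (comaximal⇔gcd≡1 n x z) com)
  (λ G≡1 → x≢z G≡1 , from (comaximal⇔gcd≡1 n x z) G≡1)
  where
  x≢z : gcd (gcd (toℕ x) n) (toℕ z) ≡ 1 → x ≢ z
  x≢z G≡1 refl = gcd≢1 (trans (sym (m∣n⇒gcd[m,n]≡m (gcd[m,n]∣m (toℕ x) n))) G≡1)

adj-respects-cell : ∀ n .{{_ : NonZero n}} {d} {x y : Fin n} (z : Fin n) →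
  InA n d x → InA n d y → d ≢ 1 → Adj n x z → Adj n y z
adj-respects-cell n z x∈A y∈A d≢1 adj =
  from (adj⇔gcd≡1 n _ z (d≢1 ∘ trans (sym y∈A)))
    (subst (λ g → gcd g (toℕ z) ≡ 1) (trans x∈A (sym y∈A))
      (to (adj⇔gcd≡1 n _ z (d≢1 ∘ trans (sym x∈A))) adj))

theorem3p9 : (n : ℕ) .{{_ : NonZero n}} → 2 ≤ n →
    -- the cells A_d (d proper divisor) cover exactly V(G₂) (they are disjoint by definition)
    ((x : Fin n) → (InG₂ n x ⇔ (∃[ d ] (ProperDivisor n d × InA n d x))))
    -- each cell is nonempty
    × ((d : ℕ) → ProperDivisor n d → ∃[ x ] InA n d x)
    -- equitability
    × ((d d′ : ℕ) → ProperDivisor n d → ProperDivisor n d′ →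
         (x y : Fin n) → InA n d x → InA n d y → nbrsIn n x d′ ≡ nbrsIn n y d′)
theorem3p9 n _ = cover , nonempty , equitable
  where
  cover : (x : Fin n) → InG₂ n x ⇔ (∃[ d ] (ProperDivisor n d × InA n d x))
  cover x = mk⇔
    (λ (x≢0 , ¬unit) → gcd (toℕ x) n ,
      (gcd[m,n]∣n (toℕ x) n , ¬unit ∘ from (isUnit⇔gcd≡1 n x) , x≢0 ∘ to (gcd≡n⇔≡0 n x)) , refl)
    (λ { (_ , (_ , d≢1 , d≢n) , refl) → d≢n ∘ from (gcd≡n⇔≡0 n x) , d≢1 ∘ to (isUnit⇔gcd≡1 n x) })

  nonempty : (d : ℕ) → ProperDivisor n d → ∃[ x ] InA n d x
  nonempty d (d∣n , _ , d≢n) = fromℕ< d<n ,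
    trans (cong (λ t → gcd t n) (toℕ-fromℕ< d<n)) (m∣n⇒gcd[m,n]≡m d∣n)
    where
    d<n : d < n
    d<n = ≤∧≢⇒< (∣⇒≤ d∣n) d≢n

  equitable : (d d′ : ℕ) → ProperDivisor n d → ProperDivisor n d′ →
    (x y : Fin n) → InA n d x → InA n d y → nbrsIn n x d′ ≡ nbrsIn n y d′
  equitable d d′ (_ , d≢1 , _) _ x y x∈A y∈A = cong length (filter-≐ _ _
    (map₂ (adj-respects-cell n _ x∈A y∈A d≢1) , map₂ (adj-respects-cell n _ y∈A x∈A d≢1))
    (allFin n))
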